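{- If a graph $G$ has a dominating induced matching and the complement graph $\overline{G}$ is not connected, then $G$ is a cograph.
   Context: A dominating induced matching of $G=(V,E)$ is a set $M\subseteq E$ such that distinct edges of $M$ are disjoint and joined by no edge of $G$, and every edge of $E\setminus M$ shares an endpoint with an edge of $M$. A cograph is a graph with no induced chordless path on 4 vertices ($P_4$). -}

module Defs where

open import Data.Nat using (ℕ)
open import Data.Fin using (Fin)
open import Data.Product using (_×_; _,_; ∃-syntax)
open import Data.Sum using (_⊎_)
open import Relation.Nullary using (¬_)
open import Relation.Binary.PropositionalEquality using (_≡_; _≢_)


record Graph (n : ℕ) : Set₁ where
  field
    Adj    : Fin n → Fin n → Set
    sym    : ∀ {u v} → Adj u v → Adj v u
    irrefl : ∀ {u} → ¬ Adj u u
open Graph public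

complement : ∀ {n} → Graph n → Graph n
complement G = record
  { Adj    = λ u v → u ≢ v × ¬ Adj G u v
  ; sym    = λ { (u≢v , ¬a) → (λ e → u≢v (Relation.Binary.PropositionalEquality.sym e))
                              , (λ a → ¬a (Graph.sym G a)) }
  ; irrefl = λ { (u≢u , _) → u≢u Relation.Binary.PropositionalEquality.refl }
  }

data Walk {n : ℕ} (G : Graph n) : Fin n → Fin n → Set where
  here : ∀ {u} → Walk G u u
  step : ∀ {u v w} → Adj G u v → Walk G v w → Walk G u w

Connected : ∀ {n} → Graph n → Set
Connected {n} G = (u v : Fin n) → Walk G u v

-- A set of edges M ⊆ E, represented as a symmetric relation contained in Adj
-- (M u v means the edge {u,v} belongs to M).
record EdgeSet {n : ℕ} (G : Graph n) : Set₁ where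
  field
    In     : Fin n → Fin n → Set
    inSym  : ∀ {u v} → In u v → In v u
    inEdge : ∀ {u v} → In u v → Adj G u v
open EdgeSet public

SameEdge : ∀ {n} → Fin n → Fin n → Fin n → Fin n → Set
SameEdge u v x y = (u ≡ x × v ≡ y) ⊎ (u ≡ y × v ≡ x)

record IsDIM {n : ℕ} (G : Graph n) (M : EdgeSet G) : Set where
  field
    induced : ∀ {u v x y} → In M u v → In M x y → ¬ SameEdge u v x y →
              (u ≢ x × u ≢ y × v ≢ x × v ≢ y) ×
              (¬ Adj G u x × ¬ Adj G u y × ¬ Adj G v x × ¬ Adj G v y)
    dominating : ∀ {u v} → Adj G u v → ¬ In M u v →
              ∃[ x ] ∃[ y ] (In M x y × (u ≡ x ⊎ u ≡ y ⊎ v ≡ x ⊎ v ≡ y))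

HasDIM : ∀ {n} → Graph n → Set₁
HasDIM G = ∃[ M ] IsDIM G M

InducedP4 : ∀ {n} → Graph n → Fin n → Fin n → Fin n → Fin n → Set
InducedP4 G a b c d =
  (a ≢ b × a ≢ c × a ≢ d × b ≢ c × b ≢ d × c ≢ d) ×
  (Adj G a b × Adj G b c × Adj G c d) ×
  (¬ Adj G a c × ¬ Adj G b d × ¬ Adj G a d)

Cograph : ∀ {n} → Graph n → Set
Cograph {n} G = ∀ (a b c d : Fin n) → ¬ InducedP4 G a b c d

module Submission where

-- The proof is by contraposition, in the double-negation fragment (membership
-- in the matching is not decidable, so every case split is classical, which is
-- harmless because all goals are negative).
--  * Matching facts: a neighbour of a matched vertex that is itself covered by
--    the matching must be its partner; hence every triangle contains an edge of
--    the matching, and no vertex can be adjacent to all four vertices of an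
--    induced P4 (such a "gem" would contain three triangles that force
--    incompatible matching edges).
--  * Complement facts: the complement of a P4 a-b-c-d is the path b-d-a-c, so
--    its vertices lie in one component of the complement.  Any vertex outside
--    that component is adjacent in G to all four, and if the whole P4 lies in the
--    component of u then every vertex v outside it is such a vertex.  So a P4
--    with no dominating vertex makes the complement connected.
-- The theorem combines the two and shifts the double negation across the
-- finite quantifiers of Connected.

open import Defs
open import Data.Nat using (ℕ; zero; suc)
open import Data.Fin using (Fin; zero; suc)
open import Data.Product using (_×_; _,_; ∃-syntax; proj₁; proj₂)
open import Data.Sum using (_⊎_; inj₁; inj₂)
open import Data.Empty using (⊥)
open import Function using (_∘_)
open import Relation.Nullary using (¬_; yes; no)
open import Relation.Nullary.Negation using (¬¬-map)
open import Relation.Nullary.Decidable using (¬¬-excluded-middle)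
open import Relation.Binary.PropositionalEquality using (_≡_; _≢_; subst)
  renaming (sym to ≡-sym)

¬¬-∀-Fin : ∀ n {P : Fin n → Set} → (∀ i → ¬ ¬ P i) → ¬ ¬ (∀ i → P i)
¬¬-∀-Fin zero    h k = k (λ ())
¬¬-∀-Fin (suc n) h k =
  h zero λ p₀ → ¬¬-∀-Fin n (h ∘ suc) λ ps → k λ { zero → p₀ ; (suc i) → ps i }

Dominates : ∀ {n} → Graph n → Fin n → Fin n → Fin n → Fin n → Fin n → Set
Dominates G z a b c d = Adj G z a × Adj G z b × Adj G z c × Adj G z d

module DominatingInducedMatching {n : ℕ} {G : Graph n} {M : EdgeSet G}
                                 (dim : IsDIM G M) where
  open IsDIM dim

  Covered : Fin n → Set
  Covered x = ∃[ p ] In M x p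

  covered-left : ∀ {x y} → In M x y → Covered x
  covered-left {y = y} xy = y , xy

  covered-right : ∀ {x y} → In M x y → Covered y
  covered-right {x = x} xy = x , inSym M xy

  -- If x is matched to p and its neighbour y is covered, then y is p:
  -- otherwise the two matching edges at x and y would be joined by the edge xy.
  matched-neighbour : ∀ {x p y} → In M x p → Adj G x y → Covered y → ¬ ¬ y ≡ p
  matched-neighbour {x} xp xy (_ , yq) y≢p = ¬¬-excluded-middle λ
    { (no different)         → proj₁ (proj₂ (induced xp yq different)) xy
    ; (yes (inj₁ (x≡y , _))) → irrefl G (subst (Adj G x) (≡-sym x≡y) xy)
    ; (yes (inj₂ (_ , p≡y))) → y≢p (≡-sym p≡y) }

  covered-edge-matched : ∀ {x y} → Adj G x y → Covered x → Covered y → ¬ ¬ In M x y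
  covered-edge-matched {x} xy (_ , xp) cy ¬xy =
    matched-neighbour xp xy cy λ y≡p → ¬xy (subst (In M x) (≡-sym y≡p) xp)

  unmatched-edge-covered : ∀ {u v} → Adj G u v → ¬ In M u v → Covered u ⊎ Covered v
  unmatched-edge-covered uv ¬uv with dominating uv ¬uv
  ... | _ , _ , xy , inj₁ u≡x               = inj₁ (subst Covered (≡-sym u≡x) (covered-left xy))
  ... | _ , _ , xy , inj₂ (inj₁ u≡y)        = inj₁ (subst Covered (≡-sym u≡y) (covered-right xy))
  ... | _ , _ , xy , inj₂ (inj₂ (inj₁ v≡x)) = inj₂ (subst Covered (≡-sym v≡x) (covered-left xy))
  ... | _ , _ , xy , inj₂ (inj₂ (inj₂ v≡y)) = inj₂ (subst Covered (≡-sym v≡y) (covered-right xy))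

  -- Every triangle contains an edge of the matching: if none did, each of its
  -- three edges would have a covered endpoint, so two adjacent vertices would be
  -- covered and their edge would be in the matching after all.
  triangle-matched-edge : ∀ {x y w} → Adj G x y → Adj G y w → Adj G x w →
                          ¬ ¬ (In M x y ⊎ In M y w ⊎ In M x w)
  triangle-matched-edge {x} {y} {w} xy yw xw none =
    pigeonhole (unmatched-edge-covered xy (none ∘ inj₁))
               (unmatched-edge-covered yw (none ∘ inj₂ ∘ inj₁))
               (unmatched-edge-covered xw (none ∘ inj₂ ∘ inj₂))
    where
    pigeonhole : Covered x ⊎ Covered y → Covered y ⊎ Covered w → Covered x ⊎ Covered w → ⊥
    pigeonhole (inj₁ cx) (inj₁ cy) _        = covered-edge-matched xy cx cy (none ∘ inj₁)
    pigeonhole (inj₁ cx) (inj₂ cw) _        = covered-edge-matched xw cx cw (none ∘ inj₂ ∘ inj₂)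
    pigeonhole (inj₂ cy) _         (inj₁ cx) = covered-edge-matched xy cx cy (none ∘ inj₁)
    pigeonhole (inj₂ cy) _         (inj₂ cw) = covered-edge-matched yw cy cw (none ∘ inj₂ ∘ inj₁)

  -- The triangles zab,
  -- zbc, zcd each contain a matching edge; every combination makes some
  -- vertex's covered neighbour differ from its partner.
  gem-free : ∀ {z a b c d} → InducedP4 G a b c d → ¬ Dominates G z a b c d
  gem-free {z} {a} ((a≢b , a≢c , _ , b≢c , b≢d , _) , (ab , bc , cd) , _) (za , zb , zc , zd) =
    triangle-matched-edge za ab zb λ
    { (inj₁ mza) → triangle-matched-edge zb bc zc λ
      { (inj₁ mzb)        → matched-neighbour mza zb (covered-right mzb) (a≢b ∘ ≡-sym)
      ; (inj₂ (inj₁ mbc)) → matched-neighbour mza zb (covered-left mbc) (a≢b ∘ ≡-sym)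
      ; (inj₂ (inj₂ mzc)) → matched-neighbour mza zc (covered-right mzc) (a≢c ∘ ≡-sym) }
    ; (inj₂ (inj₁ mab)) → triangle-matched-edge zb bc zc λ
      { (inj₁ mzb)        → matched-neighbour (inSym M mab) (sym G zb) (covered-left mzb) z≢a
      ; (inj₂ (inj₁ mbc)) → matched-neighbour (inSym M mab) bc (covered-right mbc) (a≢c ∘ ≡-sym)
      ; (inj₂ (inj₂ mzc)) → matched-neighbour mzc zb (covered-right mab) b≢c }
    ; (inj₂ (inj₂ mzb)) → triangle-matched-edge zc cd zd λ
      { (inj₁ mzc)        → matched-neighbour mzb zc (covered-right mzc) (b≢c ∘ ≡-sym)
      ; (inj₂ (inj₁ mcd)) → matched-neighbour mzb zc (covered-left mcd) (b≢c ∘ ≡-sym)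
      ; (inj₂ (inj₂ mzd)) → matched-neighbour mzb zd (covered-right mzd) (b≢d ∘ ≡-sym) } }
    where
    z≢a : z ≢ a
    z≢a z≡a = irrefl G (subst (λ t → Adj G t a) z≡a za)


module ComplementReachability {n : ℕ} (G : Graph n) where
  Gᶜ : Graph n
  Gᶜ = complement G

  Reach : Fin n → Fin n → Set
  Reach u = Walk Gᶜ u

  extend : ∀ {u x y} → Reach u x → Adj Gᶜ x y → Reach u y
  extend here       xy = step xy here
  extend (step e w) xy = step e (extend w xy)

  -- A reachable and an unreachable vertex cannot be non-adjacent in G,
  -- for then they would be adjacent in the complement.
  unreachable-adjacent : ∀ {u x y} → Reach u x → ¬ Reach u y → ¬ ¬ Adj G x y
  unreachable-adjacent {u} {x} {y} rx ¬ry ¬xy = ¬ry (extend rx (x≢y , ¬xy))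
    where
    x≢y : x ≢ y
    x≢y x≡y = ¬ry (subst (Reach u) x≡y rx)

  p4-complement-path : ∀ {a b c d} → InducedP4 G a b c d →
                       Adj Gᶜ a c × Adj Gᶜ a d × Adj Gᶜ d b
  p4-complement-path ((_ , a≢c , a≢d , _ , b≢d , _) , _ , (¬ac , ¬bd , ¬ad)) =
    (a≢c , ¬ac) , (a≢d , ¬ad) , sym Gᶜ (b≢d , ¬bd)

  module _ {a b c d : Fin n} (p4 : InducedP4 G a b c d) where
    p4-reachable : ∀ {u} → Reach u a → Reach u b × Reach u c × Reach u d
    p4-reachable ra with p4-complement-path p4
    ... | ac , ad , db = extend (extend ra ad) db , extend ra ac , extend ra ad

    p4-unreachable : ∀ {u} → ¬ Reach u a → ¬ Reach u b × ¬ Reach u c × ¬ Reach u d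
    p4-unreachable ¬ra with p4-complement-path p4
    ... | ac , ad , db =
      (λ rb → ¬ra (extend (extend rb (sym Gᶜ db)) (sym Gᶜ ad))) ,
      (λ rc → ¬ra (extend rc (sym Gᶜ ac))) ,
      (λ rd → ¬ra (extend rd (sym Gᶜ ad)))

    -- If no vertex dominates the P4, the complement is connected: an
    -- unreachable v would dominate a P4 reachable from u, and an unreachable P4
    -- would be dominated by u itself.
    complement-connected : (∀ z → ¬ Dominates G z a b c d) → ∀ u v → ¬ ¬ Reach u v
    complement-connected no-gem u v ¬uv = ¬¬-excluded-middle λ
      { (yes ra) → let (rb , rc , rd) = p4-reachable ra in
          dominator v (towards-v ra) (towards-v rb) (towards-v rc) (towards-v rd)
      ; (no ¬ra) → let (¬rb , ¬rc , ¬rd) = p4-unreachable ¬ra in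
          dominator u (from-u ¬ra) (from-u ¬rb) (from-u ¬rc) (from-u ¬rd) }
      where
      dominator : ∀ z → ¬ ¬ Adj G z a → ¬ ¬ Adj G z b → ¬ ¬ Adj G z c → ¬ ¬ Adj G z d → ⊥
      dominator z ¬¬za ¬¬zb ¬¬zc ¬¬zd =
        ¬¬za λ za → ¬¬zb λ zb → ¬¬zc λ zc → ¬¬zd λ zd → no-gem z (za , zb , zc , zd)

      towards-v : ∀ {x} → Reach u x → ¬ ¬ Adj G v x
      towards-v rx = ¬¬-map (sym G) (unreachable-adjacent rx ¬uv)

      from-u : ∀ {x} → ¬ Reach u x → ¬ ¬ Adj G u x
      from-u = unreachable-adjacent here

-- A P4 in G would, by gem-freeness, make the complement connected.
corollary3 : ∀ {n : ℕ} (G : Graph n) → HasDIM G → ¬ Connected (complement G) → Cograph G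
corollary3 {n} G (M , dim) disconnected a b c d p4 =
  ¬¬-∀-Fin n (λ u → ¬¬-∀-Fin n (connected u)) disconnected
  where
  open DominatingInducedMatching dim using (gem-free)
  open ComplementReachability G using (complement-connected)

  connected : ∀ u v → ¬ ¬ Walk (complement G) u v
  connected = complement-connected p4 (λ z → gem-free p4)
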